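{- Let $p\geq 5$ be a prime number. (1) If $p\equiv 1\pmod 4$, then \[ \sum_{k=0}^{\frac{p-5}{4}}\frac{1}{4k+1}\equiv \tfrac{3}{4}q_p(2),\quad \sum_{k=0}^{\frac{p-1}{4}}\frac{1}{4k+2}\equiv 1-\tfrac{1}{4}q_p(2),\quad \sum_{k=0}^{\frac{p-1}{4}}\frac{1}{4k+3}\equiv \tfrac{1}{2}+\tfrac{1}{4}q_p(2) \pmod p. \] (2) If $p\equiv 3\pmod 4$, then \[ \sum_{k=0}^{\frac{p-3}{4}}\frac{1}{4k+1}\equiv \tfrac{1}{4}q_p(2),\quad \sum_{k=0}^{\frac{p-3}{4}}\frac{1}{4k+2}\equiv -\tfrac{1}{4}q_p(2),\quad \sum_{k=0}^{\frac{p-7}{4}}\frac{1}{4k+3}\equiv \tfrac{3}{4}q_p(2) \pmod p. \]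
   Context: $q_p(2)=\frac{2^{p-1}-1}{p}$ is the Fermat quotient. Congruences between rational numbers whose denominators are coprime to $p$ are understood in the ring of $p$-integral rationals. -}

module Defs where

open import Data.Nat as ℕ using (ℕ; zero; suc; _^_; _∸_)
open import Data.Nat.Divisibility using (_∣_)
open import Data.Integer as ℤ using (ℤ; +_; ∣_∣)
open import Data.Rational using (ℚ; _/_; _+_; _-_; ↥_; ↧ₙ_; 0ℚ)
open import Data.Product using (_×_)
open import Relation.Nullary using (¬_)

-- Fermat quotient q_p(2) = (2^(p-1) - 1)/p  (value at p = 0 is an irrelevant convention)
qp2 : ℕ → ℚ
qp2 zero    = 0ℚ
qp2 (suc n) = (+ (2 ^ n ∸ 1)) / suc n

-- S r N = Σ_{k=0}^{N} 1/(4k + r + 1)   (so r = 0,1,2 give denominators 4k+1, 4k+2, 4k+3)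
S : ℕ → ℕ → ℚ
S r zero    = + 1 / suc r
S r (suc N) = S r N + (+ 1 / suc (4 ℕ.* suc N ℕ.+ r))

-- a ≡ b (mod p) in the ring of p-integral rationals Z_(p):
-- a - b ∈ p Z_(p), i.e. in lowest terms p divides the numerator and not the denominator.
_≡_[modℚ_] : ℚ → ℚ → ℕ → Set
a ≡ b [modℚ p ] = (p ∣ ∣ ↥ (a - b) ∣) × ¬ (p ∣ ↧ₙ (a - b))

-- Write p = 2h + 1 and q = q_p(2), so that 2^(p-1) = 1 + p q. Comparing (2h)! = h! ∏_{k≤h} (p - k)
-- with its split into odd and even factors, where the odd factor 2j - 1 equals p - 2(h - j + 1), gives
-- ∏_{k≤h} (1 - p/k) = 2^(p-1) ∏_{k≤h} (1 - p/2k); expanding both products modulo p² yields H_h ≡ -2q (mod p).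
-- The same splitting of h! itself gives 2^(p-1) ∏_{⌊h/2⌋<k≤h} (1 - p/2k)² = 1, whence H_h - H_⌊h/2⌋ ≡ q and
-- H_⌊h/2⌋ ≡ -3q. Each quarter sum then follows by pairing 1/j with 1/(p - j) ≡ -1/j, a last term beyond p
-- being 1/(p + j) ≡ 1/j.

module Submission where

open import Defs
open import Data.Nat as ℕ using (ℕ; _≤_; _∸_; _%_; _/_)
open import Data.Nat.Primality using (Prime)
open import Data.Integer using (+_)
open import Data.Rational as ℚ using (ℚ; _+_; _-_; _*_; 1ℚ; -_)
open import Data.Product using (_×_)
open import Relation.Binary.PropositionalEquality using (_≡_)

open import Algebra.Bundles using (CommutativeSemigroup)
open import Algebra.Core using (Op₂)
open import Algebra.Structures using (IsCommutativeMonoid)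
open import Data.Empty using (⊥-elim)
open import Data.Integer as ℤ using (ℤ)
import Data.Integer.Properties as ℤ
open import Data.Nat using (zero; suc; _<_; s≤s; z≤n)
open import Data.Nat.Base using (nonTrivial⇒≢1)
import Data.Nat.Coprimality as Coprimality
open import Data.Nat.Divisibility using (_∣_; divides; _∣0; ∣⇒≤; ∣1⇒≡1; ∣m+n∣m⇒∣n; ∣-refl)
import Data.Nat.DivMod as DM
open import Data.Nat.Primality using (euclidsLemma; prime⇒nonTrivial; prime⇒nonZero)
import Data.Nat.Properties as ℕ
import Data.Nat.Tactic.RingSolver as ℕ
open import Data.Product using (Σ; _,_)
open import Data.Rational using (0ℚ; toℚᵘ)
open import Data.Rational.Properties
import Data.Rational.Unnormalised as ℚᵘ
import Data.Rational.Unnormalised.Properties as ℚᵘ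
open import Data.Sum using (_⊎_; inj₁; inj₂)
open import Level using (Level; 0ℓ)
open import Relation.Binary.PropositionalEquality
open import Relation.Nullary using (¬_)
open import Relation.Nullary.Decidable.Core using (dec⇒maybe; recompute)
open import Tactic.RingSolver using (solve-∀)
import Tactic.RingSolver.Core.AlmostCommutativeRing as ACR

ℚ-ring : ACR.AlmostCommutativeRing 0ℓ 0ℓ
ℚ-ring = ACR.fromCommutativeRing +-*-commutativeRing (λ x → dec⇒maybe (0ℚ ≟ x))

module BigOperator {a : Level} {A : Set a} {_∙_ : Op₂ A} {ε : A}
                   (isCM : IsCommutativeMonoid _≡_ _∙_ ε) where

  open IsCommutativeMonoid isCM using (isCommutativeSemigroup; identityˡ; identityʳ; assoc; comm)

  commutativeSemigroup : CommutativeSemigroup a a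
  commutativeSemigroup = record { isCommutativeSemigroup = isCommutativeSemigroup }

  open import Algebra.Properties.CommutativeSemigroup commutativeSemigroup using (interchange; xy∙z≈xz∙y)

  ⨁ : (ℕ → A) → ℕ → A
  ⨁ f zero    = ε
  ⨁ f (suc n) = ⨁ f n ∙ f n

  ⨁-closed : ∀ {ℓ} (Q : A → Set ℓ) → Q ε → (∀ {x y} → Q x → Q y → Q (x ∙ y)) →
             ∀ {f} n → (∀ k → k < n → Q (f k)) → Q (⨁ f n)
  ⨁-closed Q Qε Q∙ zero    Qf = Qε
  ⨁-closed Q Qε Q∙ (suc n) Qf = Q∙ (⨁-closed Q Qε Q∙ n (λ k k<n → Qf k (ℕ.m<n⇒m<1+n k<n))) (Qf n ℕ.≤-refl)

  ⨁-cong : ∀ {f g} n → (∀ k → k < n → f k ≡ g k) → ⨁ f n ≡ ⨁ g n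
  ⨁-cong zero    eq = refl
  ⨁-cong (suc n) eq = cong₂ _∙_ (⨁-cong n (λ k k<n → eq k (ℕ.m<n⇒m<1+n k<n))) (eq n ℕ.≤-refl)

  ⨁-const-ε : ∀ n → ⨁ (λ _ → ε) n ≡ ε
  ⨁-const-ε zero    = refl
  ⨁-const-ε (suc n) = trans (identityʳ _) (⨁-const-ε n)

  ⨁-distrib : ∀ f g n → ⨁ (λ k → f k ∙ g k) n ≡ ⨁ f n ∙ ⨁ g n
  ⨁-distrib f g zero    = sym (identityʳ ε)
  ⨁-distrib f g (suc n) = trans (cong (_∙ (f n ∙ g n)) (⨁-distrib f g n)) (interchange _ _ _ _)

  ⨁-+ : ∀ f m n → ⨁ f (m ℕ.+ n) ≡ ⨁ f m ∙ ⨁ (λ k → f (m ℕ.+ k)) n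
  ⨁-+ f m zero    rewrite ℕ.+-identityʳ m = sym (identityʳ _)
  ⨁-+ f m (suc n) rewrite ℕ.+-suc m n     = trans (cong (_∙ f (m ℕ.+ n)) (⨁-+ f m n)) (assoc _ _ _)

  ⨁-suc : ∀ f n → ⨁ f (suc n) ≡ f 0 ∙ ⨁ (λ k → f (suc k)) n
  ⨁-suc f n = trans (⨁-+ f 1 n) (cong (_∙ ⨁ (λ k → f (suc k)) n) (identityˡ (f 0)))

  ⨁-reverse : ∀ f n → ⨁ f n ≡ ⨁ (λ k → f (n ∸ suc k)) n
  ⨁-reverse f zero    = refl
  ⨁-reverse f (suc n) = begin
    ⨁ f n ∙ f n                                 ≡⟨ cong (_∙ f n) (⨁-reverse f n) ⟩
    ⨁ (λ k → f (n ∸ suc k)) n ∙ f n             ≡⟨ comm _ _ ⟩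
    f n ∙ ⨁ (λ k → f (n ∸ suc k)) n             ≡⟨ sym (⨁-suc (λ k → f (suc n ∸ suc k)) n) ⟩
    ⨁ (λ k → f (suc n ∸ suc k)) (suc n)         ∎
    where open ≡-Reasoning

  ⨁-evenOdd : ∀ f n → ⨁ f (n ℕ.+ n) ≡ ⨁ (λ k → f (k ℕ.+ k)) n ∙ ⨁ (λ k → f (suc (k ℕ.+ k))) n
  ⨁-evenOdd f zero    = sym (identityʳ ε)
  ⨁-evenOdd f (suc n) rewrite ℕ.+-suc n n =
    trans (cong (λ x → (x ∙ f (n ℕ.+ n)) ∙ f (suc (n ℕ.+ n))) (⨁-evenOdd f n))
          (trans (cong (_∙ f (suc (n ℕ.+ n))) (xy∙z≈xz∙y _ _ _)) (assoc _ _ _))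

  ⨁-parity : ∀ f m n → n ≡ m ⊎ n ≡ suc m →
             ⨁ f (m ℕ.+ n) ≡ ⨁ (λ k → f (k ℕ.+ k)) n ∙ ⨁ (λ k → f (suc (k ℕ.+ k))) m
  ⨁-parity f m .m       (inj₁ refl) = ⨁-evenOdd f m
  ⨁-parity f m .(suc m) (inj₂ refl) = begin
    ⨁ f (m ℕ.+ suc m)                           ≡⟨ cong (⨁ f) (ℕ.+-suc m m) ⟩
    ⨁ f (m ℕ.+ m) ∙ f (m ℕ.+ m)                 ≡⟨ cong (_∙ f (m ℕ.+ m)) (⨁-evenOdd f m) ⟩
    (evens ∙ odds) ∙ f (m ℕ.+ m)                ≡⟨ xy∙z≈xz∙y evens odds _ ⟩
    (evens ∙ f (m ℕ.+ m)) ∙ odds                ∎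
    where
    open ≡-Reasoning
    evens = ⨁ (λ k → f (k ℕ.+ k)) m
    odds  = ⨁ (λ k → f (suc (k ℕ.+ k))) m

module Sum     = BigOperator +-0-isCommutativeMonoid renaming (⨁ to ∑)
module Product = BigOperator *-1-isCommutativeMonoid renaming (⨁ to ∏)
open Sum using (∑)
open Product using (∏)

-- Built directly in normal form rather than as i / 1, so that fromℤ i stays a constructor
-- application instead of unfolding into a gcd computation.
fromℤ : ℤ → ℚ
fromℤ i = ℚ.mkℚ i 0 (Coprimality.sym (Coprimality.1-coprimeTo _))

fromℕ : ℕ → ℚ
fromℕ n = fromℤ (+ n)

fromℤ-+ : ∀ i j → fromℤ (i ℤ.+ j) ≡ fromℤ i + fromℤ j
fromℤ-+ i j = toℚᵘ-injective (ℚᵘ.≃-trans unnormalised (ℚᵘ.≃-sym (toℚᵘ-homo-+ (fromℤ i) (fromℤ j))))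
  where
  unnormalised : ℚᵘ.mkℚᵘ (i ℤ.+ j) 0 ℚᵘ.≃ ℚᵘ.mkℚᵘ i 0 ℚᵘ.+ ℚᵘ.mkℚᵘ j 0
  unnormalised = ℚᵘ.*≡* (cong₂ (λ a b → (a ℤ.+ b) ℤ.* + 1) (sym (ℤ.*-identityʳ i)) (sym (ℤ.*-identityʳ j)))

fromℤ-* : ∀ i j → fromℤ (i ℤ.* j) ≡ fromℤ i * fromℤ j
fromℤ-* i j = toℚᵘ-injective (ℚᵘ.≃-sym (toℚᵘ-homo-* (fromℤ i) (fromℤ j)))

/-*-fromℕ : ∀ i n → (i ℚ./ suc n) * fromℕ (suc n) ≡ fromℤ i
/-*-fromℕ i n = toℚᵘ-injective (ℚᵘ.≃-trans (toℚᵘ-homo-* (i ℚ./ suc n) (fromℕ (suc n)))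
  (ℚᵘ.≃-trans (ℚᵘ.*-cong (toℚᵘ-fromℚᵘ (ℚᵘ.mkℚᵘ i n)) ℚᵘ.≃-refl) cancelled))
  where
  cancelled : ℚᵘ.mkℚᵘ i n ℚᵘ.* ℚᵘ.mkℚᵘ (+ suc n) 0 ℚᵘ.≃ ℚᵘ.mkℚᵘ i 0
  cancelled = ℚᵘ.*≡* (trans (ℤ.*-identityʳ _) (cong (λ d → i ℤ.* + d) (sym (ℕ.*-identityʳ (suc n)))))

fromℕ-+ : ∀ m n → fromℕ (m ℕ.+ n) ≡ fromℕ m + fromℕ n
fromℕ-+ m n = fromℤ-+ (+ m) (+ n)

fromℕ-* : ∀ m n → fromℕ (m ℕ.* n) ≡ fromℕ m * fromℕ n
fromℕ-* m n = trans (cong fromℤ (ℤ.pos-* m n)) (fromℤ-* (+ m) (+ n))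

fromℕ-complement : ∀ {a b c} → a ℕ.+ b ≡ c → fromℕ a ≡ fromℕ c - fromℕ b
fromℕ-complement {a} {b} refl = begin
  fromℕ a                         ≡⟨ add-sub (fromℕ a) (fromℕ b) ⟩
  (fromℕ a + fromℕ b) - fromℕ b   ≡⟨ cong (_- fromℕ b) (sym (fromℕ-+ a b)) ⟩
  fromℕ (a ℕ.+ b) - fromℕ b       ∎
  where
  open ≡-Reasoning
  add-sub : ∀ x y → x ≡ (x + y) - y
  add-sub = solve-∀ ℚ-ring

fromℕ-^ : ∀ c n → fromℕ (c ℕ.^ n) ≡ ∏ (λ _ → fromℕ c) n
fromℕ-^ c zero    = refl
fromℕ-^ c (suc n) = trans (fromℕ-* c (c ℕ.^ n))
  (trans (*-comm (fromℕ c) (fromℕ (c ℕ.^ n))) (cong (_* fromℕ c) (fromℕ-^ c n)))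

fromℕ-2^-+ : ∀ m n → fromℕ (2 ℕ.^ (m ℕ.+ n)) ≡ fromℕ (2 ℕ.^ m) * fromℕ (2 ℕ.^ n)
fromℕ-2^-+ m n = trans (cong fromℕ (ℕ.^-distribˡ-+-* 2 m n)) (fromℕ-* (2 ℕ.^ m) (2 ℕ.^ n))

*-fromℕ-cross : ∀ z b c → z * fromℕ b ≡ fromℤ c → ℚ.↥ z ℤ.* + b ≡ c ℤ.* + ℚ.↧ₙ z
*-fromℕ-cross z@(ℚ.mkℚ a d _) b c z*b≡c
  with ℚᵘ.≃-trans (ℚᵘ.≃-sym (toℚᵘ-homo-* z (fromℕ b))) (toℚᵘ-cong z*b≡c)
... | ℚᵘ.*≡* cross = trans (sym (ℤ.*-identityʳ _)) (trans cross (cong (λ x → c ℤ.* + x) (ℕ.*-identityʳ (suc d))))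

-- 1/0 is the junk value 0; every lemma below assumes a nonzero argument.
recip : ℕ → ℚ
recip zero    = 0ℚ
recip (suc n) = + 1 ℚ./ suc n

recip-inverse : ∀ n .{{_ : ℕ.NonZero n}} → recip n * fromℕ n ≡ 1ℚ
recip-inverse (suc n) = /-*-fromℕ (+ 1) n

*-cancelʳ-invertible : ∀ {x y z w} → z * w ≡ 1ℚ → x * z ≡ y * z → x ≡ y
*-cancelʳ-invertible {x} {y} {z} {w} zw≡1 xz≡yz = begin
  x             ≡⟨ sym (*-identityʳ x) ⟩
  x * 1ℚ        ≡⟨ cong (x *_) (sym zw≡1) ⟩
  x * (z * w)   ≡⟨ sym (*-assoc x z w) ⟩
  (x * z) * w   ≡⟨ cong (_* w) xz≡yz ⟩
  (y * z) * w   ≡⟨ *-assoc y z w ⟩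
  y * (z * w)   ≡⟨ cong (y *_) zw≡1 ⟩
  y * 1ℚ        ≡⟨ *-identityʳ y ⟩
  y             ∎
  where open ≡-Reasoning

*-invertible : ∀ {x x′ y y′} → x * x′ ≡ 1ℚ → y * y′ ≡ 1ℚ → (x * y) * (x′ * y′) ≡ 1ℚ
*-invertible {x} {x′} {y} {y′} xx′≡1 yy′≡1 = begin
  (x * y) * (x′ * y′)   ≡⟨ interchange x y x′ y′ ⟩
  (x * x′) * (y * y′)   ≡⟨ cong₂ _*_ xx′≡1 yy′≡1 ⟩
  1ℚ                    ∎
  where
  open ≡-Reasoning
  interchange : ∀ x y u v → (x * y) * (u * v) ≡ (x * u) * (y * v)
  interchange = solve-∀ ℚ-ring

recip-* : ∀ a b .{{_ : ℕ.NonZero a}} .{{_ : ℕ.NonZero b}} → recip (a ℕ.* b) ≡ recip a * recip b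
recip-* a b = *-cancelʳ-invertible {z = fromℕ (a ℕ.* b)} {w = recip (a ℕ.* b)}
  (trans (*-comm (fromℕ (a ℕ.* b)) (recip (a ℕ.* b))) (recip-inverse (a ℕ.* b) {{ab≢0}}))
  (trans (recip-inverse (a ℕ.* b) {{ab≢0}}) (sym (begin
    (recip a * recip b) * fromℕ (a ℕ.* b)     ≡⟨ cong ((recip a * recip b) *_) (fromℕ-* a b) ⟩
    (recip a * recip b) * (fromℕ a * fromℕ b) ≡⟨ interchange (recip a) (recip b) (fromℕ a) (fromℕ b) ⟩
    (recip a * fromℕ a) * (recip b * fromℕ b) ≡⟨ cong₂ _*_ (recip-inverse a) (recip-inverse b) ⟩
    1ℚ                                         ∎)))
  where
  open ≡-Reasoning
  ab≢0 : ℕ.NonZero (a ℕ.* b)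
  ab≢0 = ℕ.m*n≢0 a b
  interchange : ∀ x y u v → (x * y) * (u * v) ≡ (x * u) * (y * v)
  interchange = solve-∀ ℚ-ring

factorial : ℕ → ℚ
factorial n = ∏ (λ k → fromℕ (suc k)) n

factorial-invertible : ∀ n → factorial n * ∏ (λ k → recip (suc k)) n ≡ 1ℚ
factorial-invertible n = begin
  factorial n * ∏ (λ k → recip (suc k)) n   ≡⟨ sym (Product.⨁-distrib (λ k → fromℕ (suc k)) (λ k → recip (suc k)) n) ⟩
  ∏ (λ k → fromℕ (suc k) * recip (suc k)) n
    ≡⟨ Product.⨁-cong n (λ k _ → trans (*-comm (fromℕ (suc k)) (recip (suc k))) (recip-inverse (suc k))) ⟩
  ∏ (λ _ → 1ℚ) n                            ≡⟨ Product.⨁-const-ε n ⟩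
  1ℚ                                        ∎
  where open ≡-Reasoning

sign : ℕ → ℚ
sign n = ∏ (λ _ → - 1ℚ) n

sign-square : ∀ n → sign n * sign n ≡ 1ℚ
sign-square n = trans (sym (Product.⨁-distrib (λ _ → - 1ℚ) (λ _ → - 1ℚ) n)) (Product.⨁-const-ε n)

∏-double : ∀ (w : ℕ → ℕ) n → ∏ (λ k → fromℕ (2 ℕ.* w k)) n ≡ fromℕ (2 ℕ.^ n) * ∏ (λ k → fromℕ (w k)) n
∏-double w n = begin
  ∏ (λ k → fromℕ (2 ℕ.* w k)) n                    ≡⟨ Product.⨁-cong n (λ k _ → fromℕ-* 2 (w k)) ⟩
  ∏ (λ k → fromℕ 2 * fromℕ (w k)) n                ≡⟨ Product.⨁-distrib (λ _ → fromℕ 2) (λ k → fromℕ (w k)) n ⟩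
  ∏ (λ _ → fromℕ 2) n * ∏ (λ k → fromℕ (w k)) n    ≡⟨ cong (_* ∏ (λ k → fromℕ (w k)) n) (sym (fromℕ-^ 2 n)) ⟩
  fromℕ (2 ℕ.^ n) * ∏ (λ k → fromℕ (w k)) n        ∎
  where open ≡-Reasoning

∏-evens : ∀ m → ∏ (λ k → fromℕ (suc (suc (k ℕ.+ k)))) m ≡ fromℕ (2 ℕ.^ m) * factorial m
∏-evens m = trans (Product.⨁-cong m (λ k _ → cong fromℕ (twice k))) (∏-double suc m)
  where
  twice : ∀ k → suc (suc (k ℕ.+ k)) ≡ 2 ℕ.* suc k
  twice = ℕ.solve-∀

∑-*ˡ : ∀ c f n → ∑ (λ k → c * f k) n ≡ c * ∑ f n
∑-*ˡ c f zero    = sym (*-zeroʳ c)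
∑-*ˡ c f (suc n) = trans (cong (_+ c * f n) (∑-*ˡ c f n)) (sym (*-distribˡ-+ c (∑ f n) (f n)))

∑-recip-* : ∀ c (w : ℕ → ℕ) n .{{_ : ℕ.NonZero c}} .{{_ : ∀ {k} → ℕ.NonZero (w k)}} →
            ∑ (λ k → recip (c ℕ.* w k)) n ≡ recip c * ∑ (λ k → recip (w k)) n
∑-recip-* c w n = trans (Sum.⨁-cong n (λ k _ → recip-* c (w k))) (∑-*ˡ (recip c) (λ k → recip (w k)) n)

harmonic : ℕ → ℚ
harmonic n = ∑ (λ k → recip (suc k)) n

oddHarmonic : ℕ → ℚ
oddHarmonic n = ∑ (λ k → recip (suc (k ℕ.+ k))) n

complementary : ∀ {n q} (u w F : ℕ → ℕ) → (∀ t k → u t ℕ.+ w k ≡ F (t ℕ.+ suc k)) → F n ≡ q →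
                ∀ k → k < n → u (n ∸ suc k) ℕ.+ w k ≡ q
complementary {n} u w F shape Fn≡q k k<n = trans (shape (n ∸ suc k) k) (trans (cong F (ℕ.m∸n+n≡m k<n)) Fn≡q)

module Reflection (p : ℕ) where

  P : ℚ
  P = fromℕ p

  defect : (ℕ → ℕ) → ℕ → ℚ
  defect w n = ∏ (λ k → 1ℚ - P * recip (w k)) n

  ∏-reflect : ∀ n (u w : ℕ → ℕ) .{{_ : ∀ {k} → ℕ.NonZero (w k)}} →
              (∀ k → k < n → u (n ∸ suc k) ℕ.+ w k ≡ p) →
              ∏ (λ k → fromℕ (u k)) n ≡ (sign n * ∏ (λ k → fromℕ (w k)) n) * defect w n
  ∏-reflect n u w complement = begin
    ∏ (λ k → fromℕ (u k)) n                                   ≡⟨ Product.⨁-reverse _ n ⟩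
    ∏ (λ k → fromℕ (u (n ∸ suc k))) n                         ≡⟨ Product.⨁-cong n factor ⟩
    ∏ (λ k → (- 1ℚ * fromℕ (w k)) * (1ℚ - P * recip (w k))) n
      ≡⟨ Product.⨁-distrib (λ k → - 1ℚ * fromℕ (w k)) _ n ⟩
    ∏ (λ k → - 1ℚ * fromℕ (w k)) n * defect w n
      ≡⟨ cong (_* defect w n) (Product.⨁-distrib (λ _ → - 1ℚ) (λ k → fromℕ (w k)) n) ⟩
    (sign n * ∏ (λ k → fromℕ (w k)) n) * defect w n           ∎
    where
    open ≡-Reasoning
    expand : ∀ y x r → (- 1ℚ * x) * (1ℚ - y * r) ≡ y * (r * x) - x
    expand = solve-∀ ℚ-ring
    factor : ∀ k → k < n → fromℕ (u (n ∸ suc k)) ≡ (- 1ℚ * fromℕ (w k)) * (1ℚ - P * recip (w k))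
    factor k k<n = begin
      fromℕ (u (n ∸ suc k))                           ≡⟨ fromℕ-complement {b = w k} (complement k k<n) ⟩
      P - fromℕ (w k)                                 ≡⟨ cong (λ z → z - fromℕ (w k)) (sym (*-identityʳ P)) ⟩
      P * 1ℚ - fromℕ (w k)                            ≡⟨ cong (λ z → P * z - fromℕ (w k)) (sym (recip-inverse (w k))) ⟩
      P * (recip (w k) * fromℕ (w k)) - fromℕ (w k)   ≡⟨ sym (expand P (fromℕ (w k)) (recip (w k))) ⟩
      (- 1ℚ * fromℕ (w k)) * (1ℚ - P * recip (w k))   ∎

  ∏-odd-reflect : ∀ a n → suc ((a ℕ.+ n) ℕ.+ (a ℕ.+ n)) ≡ p →
    ∏ (λ k → fromℕ (suc (k ℕ.+ k))) n
      ≡ (sign n * (fromℕ (2 ℕ.^ n) * ∏ (λ k → fromℕ (suc (a ℕ.+ k))) n)) * defect (λ k → 2 ℕ.* suc (a ℕ.+ k)) n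
  ∏-odd-reflect a n refl = begin
    ∏ (λ k → fromℕ (suc (k ℕ.+ k))) n
      ≡⟨ ∏-reflect n (λ k → suc (k ℕ.+ k)) w
           (complementary (λ t → suc (t ℕ.+ t)) w (λ x → suc ((a ℕ.+ x) ℕ.+ (a ℕ.+ x))) (shape a) refl) ⟩
    (sign n * ∏ (λ k → fromℕ (w k)) n) * defect w n
      ≡⟨ cong (λ z → (sign n * z) * defect w n) (∏-double (λ k → suc (a ℕ.+ k)) n) ⟩
    (sign n * (fromℕ (2 ℕ.^ n) * ∏ (λ k → fromℕ (suc (a ℕ.+ k))) n)) * defect w n ∎
    where
    open ≡-Reasoning
    w : ℕ → ℕ
    w k = 2 ℕ.* suc (a ℕ.+ k)
    shape : ∀ a t k → suc (t ℕ.+ t) ℕ.+ 2 ℕ.* suc (a ℕ.+ k) ≡ suc ((a ℕ.+ (t ℕ.+ suc k)) ℕ.+ (a ℕ.+ (t ℕ.+ suc k)))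
    shape = ℕ.solve-∀

module _ (h : ℕ) where
  open Reflection (suc (h ℕ.+ h))

  defect-halving : defect suc h ≡ fromℕ (2 ℕ.^ (h ℕ.+ h)) * defect (λ k → 2 ℕ.* suc k) h
  defect-halving = *-cancelʳ-invertible z-invertible (begin
    D₁ * z                               ≡⟨ regroup₁ D₁ σ F ⟩
    F * ((σ * F) * D₁)                   ≡⟨ cong (F *_) (sym upper) ⟩
    F * ∏ (λ k → fromℕ (suc (h ℕ.+ k))) h ≡⟨ sym (Product.⨁-+ (λ k → fromℕ (suc k)) h h) ⟩
    factorial (h ℕ.+ h)                  ≡⟨ Product.⨁-evenOdd (λ k → fromℕ (suc k)) h ⟩
    ∏ (λ k → fromℕ (suc (k ℕ.+ k))) h * ∏ (λ k → fromℕ (suc (suc (k ℕ.+ k)))) h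
                                         ≡⟨ cong₂ _*_ (∏-odd-reflect 0 h refl) (∏-evens h) ⟩
    ((σ * (T * F)) * D₂) * (T * F)        ≡⟨ regroup₂ D₂ σ T F ⟩
    ((T * T) * D₂) * z                   ≡⟨ cong (λ t → (t * D₂) * z) (sym (fromℕ-2^-+ h h)) ⟩
    (fromℕ (2 ℕ.^ (h ℕ.+ h)) * D₂) * z   ∎)
    where
    open ≡-Reasoning
    F σ T D₁ D₂ z : ℚ
    F  = factorial h
    σ  = sign h
    T  = fromℕ (2 ℕ.^ h)
    D₁ = defect suc h
    D₂ = defect (λ k → 2 ℕ.* suc k) h
    z  = σ * (F * F)
    F′ : ℚ
    F′ = ∏ (λ k → recip (suc k)) h
    z-invertible : z * (σ * (F′ * F′)) ≡ 1ℚ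
    z-invertible = *-invertible {σ} {σ} {F * F} {F′ * F′} (sign-square h)
                     (*-invertible {F} {F′} {F} {F′} (factorial-invertible h) (factorial-invertible h))
    upper : ∏ (λ k → fromℕ (suc (h ℕ.+ k))) h ≡ (σ * F) * D₁
    upper = ∏-reflect h (λ k → suc (h ℕ.+ k)) suc
              (complementary (λ t → suc (h ℕ.+ t)) suc (λ x → suc (h ℕ.+ x)) (shape h) refl)
      where
      shape : ∀ h t k → suc (h ℕ.+ t) ℕ.+ suc k ≡ suc (h ℕ.+ (t ℕ.+ suc k))
      shape = ℕ.solve-∀
    regroup₁ : ∀ d s f → d * (s * (f * f)) ≡ f * ((s * f) * d)
    regroup₁ = solve-∀ ℚ-ring
    regroup₂ : ∀ d s t f → ((s * (t * f)) * d) * (t * f) ≡ ((t * t) * d) * (s * (f * f))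
    regroup₂ = solve-∀ ℚ-ring

module _ (m n : ℕ) (balanced : n ≡ m ⊎ n ≡ suc m) where
  open Reflection (suc ((m ℕ.+ n) ℕ.+ (m ℕ.+ n)))

  defect-upper-square : 1ℚ ≡ fromℕ (2 ℕ.^ ((m ℕ.+ n) ℕ.+ (m ℕ.+ n)))
                              * (defect (λ k → 2 ℕ.* suc (m ℕ.+ k)) n * defect (λ k → 2 ℕ.* suc (m ℕ.+ k)) n)
  defect-upper-square = begin
    1ℚ                                 ≡⟨ cong₂ _*_ signed-defect signed-defect ⟩
    ((σ * T) * R) * ((σ * T) * R)      ≡⟨ regroup σ T R ⟩
    (σ * σ) * ((T * T) * (R * R))      ≡⟨ cong₂ (λ s t → s * (t * (R * R))) (sign-square n) (sym (fromℕ-2^-+ h h)) ⟩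
    1ℚ * (fromℕ (2 ℕ.^ (h ℕ.+ h)) * (R * R)) ≡⟨ *-identityˡ _ ⟩
    fromℕ (2 ℕ.^ (h ℕ.+ h)) * (R * R)  ∎
    where
    open ≡-Reasoning
    h : ℕ
    h = m ℕ.+ n
    F σ T R U : ℚ
    F = factorial h
    σ = sign n
    T = fromℕ (2 ℕ.^ h)
    R = defect (λ k → 2 ℕ.* suc (m ℕ.+ k)) n
    U = ∏ (λ k → fromℕ (suc (m ℕ.+ k))) n
    regroup : ∀ s t r → ((s * t) * r) * ((s * t) * r) ≡ (s * s) * ((t * t) * (r * r))
    regroup = solve-∀ ℚ-ring
    regroup′ : ∀ s u r a b f → ((s * (b * u)) * r) * (a * f) ≡ ((s * (a * b)) * r) * (f * u)
    regroup′ = solve-∀ ℚ-ring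
    signed-defect : 1ℚ ≡ (σ * T) * R
    signed-defect = *-cancelʳ-invertible {z = F} (factorial-invertible h) (begin
      1ℚ * F                                     ≡⟨ *-identityˡ F ⟩
      F                                          ≡⟨ Product.⨁-parity (λ k → fromℕ (suc k)) m n balanced ⟩
      ∏ (λ k → fromℕ (suc (k ℕ.+ k))) n * ∏ (λ k → fromℕ (suc (suc (k ℕ.+ k)))) m
                                                 ≡⟨ cong₂ _*_ (∏-odd-reflect m n refl) (∏-evens m) ⟩
      ((σ * (fromℕ (2 ℕ.^ n) * U)) * R) * (fromℕ (2 ℕ.^ m) * factorial m)
                                                 ≡⟨ regroup′ σ U R (fromℕ (2 ℕ.^ m)) (fromℕ (2 ℕ.^ n)) (factorial m) ⟩
      ((σ * (fromℕ (2 ℕ.^ m) * fromℕ (2 ℕ.^ n))) * R) * (factorial m * U)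
                                                 ≡⟨ cong₂ (λ t f → ((σ * t) * R) * f) (sym (fromℕ-2^-+ m n))
                                                                                      (sym (Product.⨁-+ (λ k → fromℕ (suc k)) m n)) ⟩
      ((σ * T) * R) * F                          ∎)

module pAdic {p : ℕ} (prime : Prime p) where
  open Reflection p using (P)

  ∤-* : ∀ {a b} → ¬ p ∣ a → ¬ p ∣ b → ¬ p ∣ a ℕ.* b
  ∤-* {a} {b} p∤a p∤b p∣ab with euclidsLemma a b prime p∣ab
  ... | inj₁ p∣a = p∤a p∣a
  ... | inj₂ p∣b = p∤b p∣b

  ∤-between : ∀ {n} → 0 < n → n < p → ¬ p ∣ n
  ∤-between 0<n n<p p∣n = ℕ.<⇒≱ n<p (∣⇒≤ {{ℕ.>-nonZero 0<n}} p∣n)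

  ∤1 : ¬ p ∣ 1
  ∤1 p∣1 = nonTrivial⇒≢1 {{prime⇒nonTrivial prime}} (∣1⇒≡1 p∣1)

  record Integral (x : ℚ) : Set where
    constructor integral
    field
      denominator   : ℕ
      p∤denominator : ¬ p ∣ denominator
      numerator     : ℤ
      cleared       : x * fromℕ denominator ≡ fromℤ numerator

  Integral-fromℤ : ∀ i → Integral (fromℤ i)
  Integral-fromℤ i = integral 1 ∤1 i (*-identityʳ (fromℤ i))

  Integral-+ : ∀ {x y} → Integral x → Integral y → Integral (x + y)
  Integral-+ {x} {y} (integral b₁ p∤b₁ a₁ x-cleared) (integral b₂ p∤b₂ a₂ y-cleared) =
    integral (b₁ ℕ.* b₂) (∤-* p∤b₁ p∤b₂) (a₁ ℤ.* + b₂ ℤ.+ a₂ ℤ.* + b₁) (begin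
      (x + y) * fromℕ (b₁ ℕ.* b₂)                              ≡⟨ cong ((x + y) *_) (fromℕ-* b₁ b₂) ⟩
      (x + y) * (fromℕ b₁ * fromℕ b₂)                          ≡⟨ distribute x y (fromℕ b₁) (fromℕ b₂) ⟩
      (x * fromℕ b₁) * fromℕ b₂ + (y * fromℕ b₂) * fromℕ b₁    ≡⟨ cong₂ (λ s t → s * fromℕ b₂ + t * fromℕ b₁) x-cleared y-cleared ⟩
      fromℤ a₁ * fromℤ (+ b₂) + fromℤ a₂ * fromℤ (+ b₁)        ≡⟨ cong₂ _+_ (sym (fromℤ-* a₁ (+ b₂))) (sym (fromℤ-* a₂ (+ b₁))) ⟩
      fromℤ (a₁ ℤ.* + b₂) + fromℤ (a₂ ℤ.* + b₁)                ≡⟨ sym (fromℤ-+ (a₁ ℤ.* + b₂) (a₂ ℤ.* + b₁)) ⟩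
      fromℤ (a₁ ℤ.* + b₂ ℤ.+ a₂ ℤ.* + b₁)                      ∎)
    where
    open ≡-Reasoning
    distribute : ∀ x y u v → (x + y) * (u * v) ≡ (x * u) * v + (y * v) * u
    distribute = solve-∀ ℚ-ring

  Integral-* : ∀ {x y} → Integral x → Integral y → Integral (x * y)
  Integral-* {x} {y} (integral b₁ p∤b₁ a₁ x-cleared) (integral b₂ p∤b₂ a₂ y-cleared) =
    integral (b₁ ℕ.* b₂) (∤-* p∤b₁ p∤b₂) (a₁ ℤ.* a₂) (begin
      (x * y) * fromℕ (b₁ ℕ.* b₂)           ≡⟨ cong ((x * y) *_) (fromℕ-* b₁ b₂) ⟩
      (x * y) * (fromℕ b₁ * fromℕ b₂)       ≡⟨ interchange x y (fromℕ b₁) (fromℕ b₂) ⟩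
      (x * fromℕ b₁) * (y * fromℕ b₂)       ≡⟨ cong₂ _*_ x-cleared y-cleared ⟩
      fromℤ a₁ * fromℤ a₂                   ≡⟨ sym (fromℤ-* a₁ a₂) ⟩
      fromℤ (a₁ ℤ.* a₂)                     ∎)
    where
    open ≡-Reasoning
    interchange : ∀ x y u v → (x * y) * (u * v) ≡ (x * u) * (y * v)
    interchange = solve-∀ ℚ-ring

  Integral-neg : ∀ {x} → Integral x → Integral (- x)
  Integral-neg {x} x-integral = subst Integral (minus-one x) (Integral-* (Integral-fromℤ (ℤ.- ℤ.1ℤ)) x-integral)
    where
    minus-one : ∀ x → fromℤ (ℤ.- ℤ.1ℤ) * x ≡ - x
    minus-one = solve-∀ ℚ-ring

  Integral-sub : ∀ {x y} → Integral x → Integral y → Integral (x - y)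
  Integral-sub x-integral y-integral = Integral-+ x-integral (Integral-neg y-integral)

  Integral-recip : ∀ {n} → ¬ p ∣ n → Integral (recip n)
  Integral-recip {zero}  p∤0 = ⊥-elim (p∤0 (p ∣0))
  Integral-recip {suc n} p∤n = integral (suc n) p∤n (+ 1) (recip-inverse (suc n))

  Integral-P : Integral P
  Integral-P = Integral-fromℤ (+ p)

  Integral-∑ : ∀ {f} n → (∀ k → k < n → Integral (f k)) → Integral (∑ f n)
  Integral-∑ = Sum.⨁-closed Integral (Integral-fromℤ (+ 0)) Integral-+

  Integral-∏ : ∀ {f} n → (∀ k → k < n → Integral (f k)) → Integral (∏ f n)
  Integral-∏ = Product.⨁-closed Integral (Integral-fromℤ (+ 1)) Integral-*

  Divisible : ℕ → ℚ → Set
  Divisible zero    x = Integral x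
  Divisible (suc n) x = Σ ℚ λ y → Divisible n y × x ≡ P * y

  Divisible-P* : ∀ n {x} → Divisible n x → Divisible (suc n) (P * x)
  Divisible-P* n {x} d = x , d , refl

  Divisible-0ℚ : ∀ n → Divisible n 0ℚ
  Divisible-0ℚ zero    = Integral-fromℤ (+ 0)
  Divisible-0ℚ (suc n) = 0ℚ , Divisible-0ℚ n , sym (*-zeroʳ P)

  Divisible-+ : ∀ n {x y} → Divisible n x → Divisible n y → Divisible n (x + y)
  Divisible-+ zero    dx dy = Integral-+ dx dy
  Divisible-+ (suc n) (x′ , dx′ , refl) (y′ , dy′ , refl) =
    x′ + y′ , Divisible-+ n dx′ dy′ , sym (*-distribˡ-+ P x′ y′)

  Divisible-*ˡ : ∀ n {c x} → Integral c → Divisible n x → Divisible n (c * x)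
  Divisible-*ˡ zero    ic dx = Integral-* ic dx
  Divisible-*ˡ (suc n) {c} ic (x′ , dx′ , refl) = c * x′ , Divisible-*ˡ n ic dx′ , commute c P x′
    where
    commute : ∀ c P x → c * (P * x) ≡ P * (c * x)
    commute = solve-∀ ℚ-ring

  Divisible-weaken : ∀ n {x} → Divisible (suc n) x → Divisible n x
  Divisible-weaken zero    (x′ , dx′ , refl) = Integral-* Integral-P dx′
  Divisible-weaken (suc n) (x′ , dx′ , refl) = x′ , Divisible-weaken n dx′ , refl

  Divisible-P*⁻¹ : ∀ n {x} → Divisible (suc n) (P * x) → Divisible n x
  Divisible-P*⁻¹ n {x} (y , dy , Px≡Py) = subst (Divisible n) (sym x≡y) dy
    where
    x≡y : x ≡ y
    x≡y = *-cancelʳ-invertible {z = P} {w = recip p} (trans (*-comm P (recip p)) (recip-inverse p {{prime⇒nonZero prime}}))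
            (trans (*-comm x P) (trans Px≡Py (*-comm P y)))

  Divisible-∑ : ∀ {f} n → (∀ k → k < n → Divisible 1 (f k)) → Divisible 1 (∑ f n)
  Divisible-∑ = Sum.⨁-closed (Divisible 1) (Divisible-0ℚ 1) (Divisible-+ 1)

  ∏-1-P*-expansion : ∀ f n → (∀ k → k < n → Integral (f k)) →
                     Divisible 2 (∏ (λ k → 1ℚ - P * f k) n - (1ℚ - P * ∑ f n))
  ∏-1-P*-expansion f zero    _          = subst (Divisible 2) (vanish P) (Divisible-0ℚ 2)
    where
    vanish : ∀ P → 0ℚ ≡ 1ℚ - (1ℚ - P * 0ℚ)
    vanish = solve-∀ ℚ-ring
  ∏-1-P*-expansion f (suc n) f-integral =
    subst (Divisible 2) (step A Σf F P)
      (Divisible-+ 2 (Divisible-*ˡ 2 (Integral-sub (Integral-fromℤ (+ 1)) (Integral-* Integral-P F-integral))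
                                     (∏-1-P*-expansion f n (λ k k<n → f-integral k (ℕ.m<n⇒m<1+n k<n))))
                     (Divisible-P* 1 (Divisible-P* 0 (Integral-* Σf-integral F-integral))))
    where
    A Σf F : ℚ
    A  = ∏ (λ k → 1ℚ - P * f k) n
    Σf = ∑ f n
    F  = f n
    F-integral : Integral F
    F-integral = f-integral n ℕ.≤-refl
    Σf-integral : Integral Σf
    Σf-integral = Integral-∑ n (λ k k<n → f-integral k (ℕ.m<n⇒m<1+n k<n))
    step : ∀ A S F P → (1ℚ - P * F) * (A - (1ℚ - P * S)) + P * (P * (S * F)) ≡ A * (1ℚ - P * F) - (1ℚ - P * (S + F))
    step = solve-∀ ℚ-ring

  Integral-recip-below : ∀ n .{{_ : ℕ.NonZero n}} → n < p → Integral (recip n)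
  Integral-recip-below n n<p = Integral-recip (∤-between (ℕ.>-nonZero⁻¹ n) n<p)

  recip-+-complement : ∀ a b .{{_ : ℕ.NonZero a}} .{{_ : ℕ.NonZero b}} → a ℕ.+ b ≡ p →
                       Divisible 1 (recip a + recip b)
  recip-+-complement a b refl =
    subst (Divisible 1) (sym split)
      (Divisible-P* 0 (Integral-* (Integral-recip-below a (ℕ.m<m+n a (ℕ.>-nonZero⁻¹ b)))
                                  (Integral-recip-below b (ℕ.m<n+m b (ℕ.>-nonZero⁻¹ a)))))
    where
    open ≡-Reasoning
    expand : ∀ A B x y → (A + B) * (x * y) ≡ (x * A) * y + (y * B) * x
    expand = solve-∀ ℚ-ring
    split : recip a + recip b ≡ fromℕ (a ℕ.+ b) * (recip a * recip b)
    split = sym (begin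
      fromℕ (a ℕ.+ b) * (recip a * recip b)                   ≡⟨ cong (_* (recip a * recip b)) (fromℕ-+ a b) ⟩
      (fromℕ a + fromℕ b) * (recip a * recip b)               ≡⟨ expand (fromℕ a) (fromℕ b) (recip a) (recip b) ⟩
      (recip a * fromℕ a) * recip b + (recip b * fromℕ b) * recip a
                                                              ≡⟨ cong₂ (λ s t → s * recip b + t * recip a) (recip-inverse a) (recip-inverse b) ⟩
      1ℚ * recip b + 1ℚ * recip a                             ≡⟨ cong₂ _+_ (*-identityˡ (recip b)) (*-identityˡ (recip a)) ⟩
      recip b + recip a                                       ≡⟨ +-comm (recip b) (recip a) ⟩
      recip a + recip b                                       ∎)

  ∑-reflect : ∀ n (u w : ℕ → ℕ) .{{_ : ∀ {k} → ℕ.NonZero (u k)}} .{{_ : ∀ {k} → ℕ.NonZero (w k)}} →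
              (∀ k → k < n → u (n ∸ suc k) ℕ.+ w k ≡ p) →
              Divisible 1 (∑ (λ k → recip (u k)) n + ∑ (λ k → recip (w k)) n)
  ∑-reflect n u w complement = subst (Divisible 1) regroup
    (Divisible-∑ n (λ k k<n → recip-+-complement (u (n ∸ suc k)) (w k) (complement k k<n)))
    where
    regroup : ∑ (λ k → recip (u (n ∸ suc k)) + recip (w k)) n ≡ ∑ (λ k → recip (u k)) n + ∑ (λ k → recip (w k)) n
    regroup = trans (Sum.⨁-distrib (λ k → recip (u (n ∸ suc k))) (λ k → recip (w k)) n)
                    (cong (_+ ∑ (λ k → recip (w k)) n) (sym (Sum.⨁-reverse (λ k → recip (u k)) n)))

  recip-shift : ∀ j → 0 < j → j < p → Divisible 1 (fromℕ j * recip (p ℕ.+ j) - 1ℚ)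
  recip-shift j 0<j j<p = subst (Divisible 1) (sym shifted)
    (Divisible-P* 0 (Integral-neg (Integral-recip p∤p+j)))
    where
    open ≡-Reasoning
    p∤p+j : ¬ p ∣ p ℕ.+ j
    p∤p+j p∣p+j = ∤-between 0<j j<p (∣m+n∣m⇒∣n p∣p+j ∣-refl)
    p+j≢0 : ℕ.NonZero (p ℕ.+ j)
    p+j≢0 = ℕ.>-nonZero (ℕ.<-≤-trans 0<j (ℕ.m≤n+m j p))
    rearrange : ∀ J R P → J * R - R * (P + J) ≡ P * (- R)
    rearrange = solve-∀ ℚ-ring
    R : ℚ
    R = recip (p ℕ.+ j)
    shifted : fromℕ j * R - 1ℚ ≡ P * (- R)
    shifted = begin
      fromℕ j * R - 1ℚ                       ≡⟨ cong (λ z → fromℕ j * R - z) (sym (recip-inverse (p ℕ.+ j) {{p+j≢0}})) ⟩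
      fromℕ j * R - R * fromℕ (p ℕ.+ j)      ≡⟨ cong (λ z → fromℕ j * R - R * z) (fromℕ-+ p j) ⟩
      fromℕ j * R - R * (P + fromℕ j)        ≡⟨ rearrange (fromℕ j) R P ⟩
      P * (- R)                              ∎

  Divisible⇒p∣↥ : ∀ z → Divisible 1 z → p ∣ ℤ.∣ ℚ.↥ z ∣ × ¬ p ∣ ℚ.↧ₙ z
  Divisible⇒p∣↥ z@(ℚ.mkℚ num den-1 coprime) (y , integral d p∤d c y*d≡c , z≡P*y) = p∣num , p∤den
    where
    open ≡-Reasoning
    z*d≡p*c : z * fromℕ d ≡ fromℤ (+ p ℤ.* c)
    z*d≡p*c = begin
      z * fromℕ d           ≡⟨ cong (_* fromℕ d) z≡P*y ⟩
      (P * y) * fromℕ d     ≡⟨ *-assoc P y (fromℕ d) ⟩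
      P * (y * fromℕ d)     ≡⟨ cong (P *_) y*d≡c ⟩
      P * fromℤ c           ≡⟨ sym (fromℤ-* (+ p) c) ⟩
      fromℤ (+ p ℤ.* c)     ∎
    ∣num∣*d≡q*p : ℤ.∣ num ∣ ℕ.* d ≡ (ℤ.∣ c ∣ ℕ.* suc den-1) ℕ.* p
    ∣num∣*d≡q*p = begin
      ℤ.∣ num ∣ ℕ.* d                       ≡⟨ sym (ℤ.abs-* num (+ d)) ⟩
      ℤ.∣ num ℤ.* + d ∣                     ≡⟨ cong ℤ.∣_∣ (*-fromℕ-cross z d (+ p ℤ.* c) z*d≡p*c) ⟩
      ℤ.∣ (+ p ℤ.* c) ℤ.* + suc den-1 ∣     ≡⟨ ℤ.abs-* (+ p ℤ.* c) (+ suc den-1) ⟩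
      ℤ.∣ + p ℤ.* c ∣ ℕ.* suc den-1         ≡⟨ cong (ℕ._* suc den-1) (ℤ.abs-* (+ p) c) ⟩
      p ℕ.* ℤ.∣ c ∣ ℕ.* suc den-1           ≡⟨ rotate p ℤ.∣ c ∣ (suc den-1) ⟩
      (ℤ.∣ c ∣ ℕ.* suc den-1) ℕ.* p         ∎
      where
      rotate : ∀ p c d → p ℕ.* c ℕ.* d ≡ (c ℕ.* d) ℕ.* p
      rotate = ℕ.solve-∀
    p∣num : p ∣ ℤ.∣ num ∣
    p∣num with euclidsLemma ℤ.∣ num ∣ d prime (divides (ℤ.∣ c ∣ ℕ.* suc den-1) ∣num∣*d≡q*p)
    ... | inj₁ p∣num = p∣num
    ... | inj₂ p∣d   = ⊥-elim (p∤d p∣d)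
    p∤den : ¬ p ∣ suc den-1
    -- The coprimality of the normal form is irrelevant, so it is recomputed from p ≟ 1.
    p∤den p∣den = ∤1 (subst (p ∣_) (recompute (ℕ._≟_ p 1) (coprime (p∣num , p∣den))) ∣-refl)

  Divisible⇒≡[modℚ] : ∀ a b → Divisible 1 (a - b) → a ≡ b [modℚ p ]
  Divisible⇒≡[modℚ] a b = Divisible⇒p∣↥ (a - b)

-- p = 2h + 1 with h = m + n, m = ⌊h/2⌋ = ⌊p/4⌋ and n = ⌈h/2⌉.
module Harmonic (m n : ℕ) (balanced : n ≡ m ⊎ n ≡ suc m)
                (prime : Prime (suc ((m ℕ.+ n) ℕ.+ (m ℕ.+ n)))) where

  h p : ℕ
  h = m ℕ.+ n
  p = suc (h ℕ.+ h)

  open pAdic prime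
  open Reflection p using (P; defect)

  Q G : ℚ
  Q = qp2 p
  G = fromℕ (2 ℕ.^ (h ℕ.+ h))

  G≡1+P*Q : G ≡ 1ℚ + P * Q
  G≡1+P*Q = begin
    G                    ≡⟨ add-sub G ⟩
    1ℚ + (G - 1ℚ)        ≡⟨ cong (λ z → 1ℚ + z) (sym (fromℕ-complement {b = 1} (ℕ.m∸n+n≡m (ℕ.m^n>0 2 (h ℕ.+ h))))) ⟩
    1ℚ + fromℕ (2 ℕ.^ (h ℕ.+ h) ∸ 1) ≡⟨ cong (λ z → 1ℚ + z) (sym (/-*-fromℕ (+ (2 ℕ.^ (h ℕ.+ h) ∸ 1)) (h ℕ.+ h))) ⟩
    1ℚ + Q * P           ≡⟨ cong (λ z → 1ℚ + z) (*-comm Q P) ⟩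
    1ℚ + P * Q           ∎
    where
    open ≡-Reasoning
    add-sub : ∀ x → x ≡ 1ℚ + (x - 1ℚ)
    add-sub = solve-∀ ℚ-ring

  Integral-recip-≤ : ∀ x .{{_ : ℕ.NonZero x}} → x ≤ h ℕ.+ h → Integral (recip x)
  Integral-recip-≤ x x≤2h = Integral-recip-below x (s≤s x≤2h)

  double-≤ : ∀ {x} → x ≤ h → 2 ℕ.* x ≤ h ℕ.+ h
  double-≤ {x} x≤h = subst (_≤ h ℕ.+ h) (cong (x ℕ.+_) (sym (ℕ.+-identityʳ x))) (ℕ.+-mono-≤ x≤h x≤h)

  upper-index-≤ : ∀ {k} → k < n → suc (m ℕ.+ k) ≤ h
  upper-index-≤ {k} k<n = subst (_≤ h) (ℕ.+-suc m k) (ℕ.+-monoʳ-≤ m k<n)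

  2<p : 2 < p
  2<p = odd>2 h (nonTrivial⇒≢1 {{prime⇒nonTrivial prime}})
    where
    odd>2 : ∀ x → suc (x ℕ.+ x) ≢ 1 → 2 < suc (x ℕ.+ x)
    odd>2 zero    p≢1 = ⊥-elim (p≢1 refl)
    odd>2 (suc x) _   = s≤s (s≤s (ℕ.≤-trans (s≤s z≤n) (ℕ.m≤n+m (suc x) x)))

  Integral-half : Integral (recip 2)
  Integral-half = Integral-recip-below 2 2<p

  tail : ℚ
  tail = ∑ (λ k → recip (suc (m ℕ.+ k))) n

  harmonic-split : harmonic h ≡ harmonic m + tail
  harmonic-split = Sum.⨁-+ (λ k → recip (suc k)) m n

  harmonic-parity : harmonic h ≡ oddHarmonic n + recip 2 * harmonic m
  harmonic-parity = trans (Sum.⨁-parity (λ k → recip (suc k)) m n balanced)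
                          (cong (λ z → oddHarmonic n + z)
                                (trans (Sum.⨁-cong m (λ k _ → cong recip (twice k))) (∑-recip-* 2 suc m)))
    where
    twice : ∀ k → suc (suc (k ℕ.+ k)) ≡ 2 ℕ.* suc k
    twice = ℕ.solve-∀

  Integral-harmonic : Integral (harmonic h)
  Integral-harmonic = Integral-∑ h (λ k k<h → Integral-recip-≤ (suc k) (ℕ.≤-trans k<h (ℕ.m≤m+n h h)))

  Integral-tail : Integral tail
  Integral-tail = Integral-∑ n (λ k k<n → Integral-recip-≤ (suc (m ℕ.+ k)) (ℕ.≤-trans (upper-index-≤ k<n) (ℕ.m≤m+n h h)))

  R₂ R₃ : ℚ
  R₂ = defect (λ k → 2 ℕ.* suc k) h
  R₃ = defect (λ k → 2 ℕ.* suc (m ℕ.+ k)) n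

  defect-expansion : ∀ w n .{{_ : ∀ {k} → ℕ.NonZero (w k)}} → (∀ k → k < n → w k ≤ h ℕ.+ h) →
                     Divisible 2 (defect w n - (1ℚ - P * ∑ (λ k → recip (w k)) n))
  defect-expansion w n w≤2h = ∏-1-P*-expansion (λ k → recip (w k)) n (λ k k<n → Integral-recip-≤ (w k) (w≤2h k k<n))

  defect₁-expansion : Divisible 2 ((1ℚ + P * Q) * R₂ - (1ℚ - P * harmonic h))
  defect₁-expansion = subst (λ r → Divisible 2 (r - (1ℚ - P * harmonic h)))
                            (trans (defect-halving h) (cong (_* R₂) G≡1+P*Q))
                            (defect-expansion suc h (λ k k<h → ℕ.≤-trans k<h (ℕ.m≤m+n h h)))

  defect₂-expansion : Divisible 2 (R₂ - (1ℚ - P * (recip 2 * harmonic h)))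
  defect₂-expansion = subst (λ s → Divisible 2 (R₂ - (1ℚ - P * s))) (∑-recip-* 2 suc h)
                            (defect-expansion (λ k → 2 ℕ.* suc k) h (λ k k<h → double-≤ k<h))

  defect₃-expansion : Divisible 2 (R₃ - (1ℚ - P * (recip 2 * tail)))
  defect₃-expansion = subst (λ s → Divisible 2 (R₃ - (1ℚ - P * s)))
                            (∑-recip-* 2 (λ k → suc (m ℕ.+ k)) n)
                            (defect-expansion (λ k → 2 ℕ.* suc (m ℕ.+ k)) n (λ k k<n → double-≤ (upper-index-≤ k<n)))

  defect-minus-one : ∀ R S → Divisible 2 (R - (1ℚ - P * S)) → Integral S → Divisible 1 (R - 1ℚ)
  defect-minus-one R S d S-integral =
    subst (Divisible 1) (rearrange R S P) (Divisible-+ 1 (Divisible-weaken 1 d) (Divisible-P* 0 (Integral-neg S-integral)))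
    where
    rearrange : ∀ R S P → (R - (1ℚ - P * S)) + P * (- S) ≡ R - 1ℚ
    rearrange = solve-∀ ℚ-ring

  Integral-1+P*Q : Integral (1ℚ + P * Q)
  Integral-1+P*Q = subst Integral G≡1+P*Q (Integral-fromℤ (+ (2 ℕ.^ (h ℕ.+ h))))

  -- Fermat's little theorem 2^(p-1) ≡ 1 (mod p), read off from the two defects.
  Integral-Q : Integral Q
  Integral-Q = Divisible-P*⁻¹ 0 (subst (Divisible 1) (rearrange R₂ P Q)
    (Divisible-+ 1 (defect-minus-one ((1ℚ + P * Q) * R₂) (harmonic h) defect₁-expansion Integral-harmonic)
                   (Divisible-*ˡ 1 (Integral-neg Integral-1+P*Q)
                                   (defect-minus-one R₂ (recip 2 * harmonic h) defect₂-expansion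
                                                     (Integral-* Integral-half Integral-harmonic)))))
    where
    rearrange : ∀ R P Q → ((1ℚ + P * Q) * R - 1ℚ) + (- (1ℚ + P * Q)) * (R - 1ℚ) ≡ P * Q
    rearrange = solve-∀ ℚ-ring

  harmonic-half-congruence : Divisible 1 (recip 2 * harmonic h + Q)
  harmonic-half-congruence = Divisible-P*⁻¹ 1 (subst (Divisible 2) (rearrange R₂ P Q (harmonic h))
    (Divisible-+ 2 (Divisible-+ 2 defect₁-expansion (Divisible-*ˡ 2 (Integral-neg Integral-1+P*Q) defect₂-expansion))
                   (Divisible-P* 1 (Divisible-P* 0 (Integral-* Integral-Q (Integral-* Integral-half Integral-harmonic))))))
    where
    rearrange : ∀ R P Q H → (((1ℚ + P * Q) * R - (1ℚ - P * H)) + (- (1ℚ + P * Q)) * (R - (1ℚ - P * (recip 2 * H))))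
                              + P * (P * (Q * (recip 2 * H)))
                            ≡ P * (recip 2 * H + Q)
    rearrange = solve-∀ ℚ-ring

  -- p (q - tail) = c (R₃ - (1 - p T₂)) - p² Y + (2^(p-1) R₃² - 1), and the last term vanishes.
  harmonic-tail-congruence : Divisible 1 (Q - tail)
  harmonic-tail-congruence = Divisible-P*⁻¹ 1 (subst (Divisible 2) identity
    (Divisible-+ 2 (Divisible-*ˡ 2 Integral-c defect₃-expansion) (Divisible-P* 1 (Divisible-P* 0 (Integral-neg Integral-Y)))))
    where
    open ≡-Reasoning
    T₂ c Y : ℚ
    T₂ = recip 2 * tail
    c  = - ((1ℚ + P * Q) * (R₃ + (1ℚ - P * T₂)))
    Y  = T₂ * T₂ - fromℕ 2 * Q * T₂ + P * Q * T₂ * T₂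
    Integral-T₂ : Integral T₂
    Integral-T₂ = Integral-* Integral-half Integral-tail
    Integral-c : Integral c
    Integral-c = Integral-neg (Integral-* Integral-1+P*Q
      (Integral-+ (Integral-∏ n (λ k k<n → Integral-sub (Integral-fromℤ (+ 1)) (Integral-* Integral-P
                     (Integral-recip-≤ (2 ℕ.* suc (m ℕ.+ k)) (double-≤ (upper-index-≤ k<n))))))
                  (Integral-sub (Integral-fromℤ (+ 1)) (Integral-* Integral-P Integral-T₂))))
    Integral-Y : Integral Y
    Integral-Y = Integral-+ (Integral-sub (Integral-* Integral-T₂ Integral-T₂)
                                          (Integral-* (Integral-* (Integral-fromℤ (+ 2)) Integral-Q) Integral-T₂))
                            (Integral-* (Integral-* (Integral-* Integral-P Integral-Q) Integral-T₂) Integral-T₂)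
    square-vanishes : (1ℚ + P * Q) * (R₃ * R₃) - 1ℚ ≡ 0ℚ
    square-vanishes = begin
      (1ℚ + P * Q) * (R₃ * R₃) - 1ℚ   ≡⟨ cong (λ g → g * (R₃ * R₃) - 1ℚ) (sym G≡1+P*Q) ⟩
      G * (R₃ * R₃) - 1ℚ              ≡⟨ cong (_- 1ℚ) (sym (defect-upper-square m n balanced)) ⟩
      1ℚ - 1ℚ                         ≡⟨ +-inverseʳ 1ℚ ⟩
      0ℚ                              ∎
    rearrange : ∀ R P Q T → P * (Q - T)
      ≡ ((- ((1ℚ + P * Q) * (R + (1ℚ - P * (recip 2 * T))))) * (R - (1ℚ - P * (recip 2 * T)))
          + P * (P * (- ((recip 2 * T) * (recip 2 * T) - fromℕ 2 * Q * (recip 2 * T) + P * Q * (recip 2 * T) * (recip 2 * T)))))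
        + ((1ℚ + P * Q) * (R * R) - 1ℚ)
    rearrange = solve-∀ ℚ-ring
    identity : c * (R₃ - (1ℚ - P * T₂)) + P * (P * (- Y)) ≡ P * (Q - tail)
    identity = sym (begin
      P * (Q - tail)                                         ≡⟨ rearrange R₃ P Q tail ⟩
      X + ((1ℚ + P * Q) * (R₃ * R₃) - 1ℚ)                    ≡⟨ cong (λ z → X + z) square-vanishes ⟩
      X + 0ℚ                                                 ≡⟨ +-identityʳ X ⟩
      X                                                      ∎)
      where
      X : ℚ
      X = c * (R₃ - (1ℚ - P * T₂)) + P * (P * (- Y))

  harmonic-lower-congruence : Divisible 1 (harmonic m + fromℕ 3 * Q)
  harmonic-lower-congruence = subst (Divisible 1) identity
    (Divisible-+ 1 harmonic-tail-congruence (Divisible-*ˡ 1 (Integral-fromℤ (+ 2)) harmonic-half-congruence))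
    where
    rearrange : ∀ Q T M → (Q - T) + fromℕ 2 * (recip 2 * (M + T) + Q) ≡ M + fromℕ 3 * Q
    rearrange = solve-∀ ℚ-ring
    identity : (Q - tail) + fromℕ 2 * (recip 2 * harmonic h + Q) ≡ harmonic m + fromℕ 3 * Q
    identity = trans (cong (λ H → (Q - tail) + fromℕ 2 * (recip 2 * H + Q)) harmonic-split) (rearrange Q tail (harmonic m))

  oddHarmonic-congruence : Divisible 1 (oddHarmonic n + recip 2 * Q)
  oddHarmonic-congruence = subst (Divisible 1) identity
    (Divisible-+ 1 (Divisible-*ˡ 1 (Integral-fromℤ (+ 2)) harmonic-half-congruence)
                   (Divisible-*ˡ 1 (Integral-neg Integral-half) harmonic-lower-congruence))
    where
    rearrange : ∀ O M Q → fromℕ 2 * (recip 2 * (O + recip 2 * M) + Q) + (- recip 2) * (M + fromℕ 3 * Q) ≡ O + recip 2 * Q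
    rearrange = solve-∀ ℚ-ring
    identity : fromℕ 2 * (recip 2 * harmonic h + Q) + (- recip 2) * (harmonic m + fromℕ 3 * Q) ≡ oddHarmonic n + recip 2 * Q
    identity = trans (cong (λ H → fromℕ 2 * (recip 2 * H + Q) + (- recip 2) * (harmonic m + fromℕ 3 * Q)) harmonic-parity)
                     (rearrange (oddHarmonic n) (harmonic m) Q)

S≡∑ : ∀ r N → S r N ≡ ∑ (λ k → recip (suc (4 ℕ.* k ℕ.+ r))) (suc N)
S≡∑ r zero    = sym (+-identityˡ (recip (suc r)))
S≡∑ r (suc N) = cong (_+ recip (suc (4 ℕ.* suc N ℕ.+ r))) (S≡∑ r N)

∑-4k+2 : ∀ n → ∑ (λ k → recip (suc (4 ℕ.* k ℕ.+ 1))) n ≡ recip 2 * oddHarmonic n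
∑-4k+2 n = trans (Sum.⨁-cong n (λ k _ → cong recip (twice-odd k))) (∑-recip-* 2 (λ k → suc (k ℕ.+ k)) n)
  where
  twice-odd : ∀ k → suc (4 ℕ.* k ℕ.+ 1) ≡ 2 ℕ.* suc (k ℕ.+ k)
  twice-odd = ℕ.solve-∀

module QuarterSums≡1 (m₀ : ℕ) (prime : Prime (suc ((suc m₀ ℕ.+ suc m₀) ℕ.+ (suc m₀ ℕ.+ suc m₀)))) where

  m : ℕ
  m = suc m₀

  open pAdic prime
  open Harmonic m m (inj₁ refl) prime

  4<p : 4 < p
  4<p = subst (4 <_) (sym (form m₀)) (s≤s (s≤s (s≤s (s≤s (s≤s z≤n)))))
    where
    form : ∀ m₀ → suc ((suc m₀ ℕ.+ suc m₀) ℕ.+ (suc m₀ ℕ.+ suc m₀)) ≡ 5 ℕ.+ 4 ℕ.* m₀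
    form = ℕ.solve-∀

  S₀-congruence : Divisible 1 (S 0 m₀ - (+ 3 ℚ./ 4) * Q)
  S₀-congruence = subst (Divisible 1) identity
    (Divisible-+ 1 reflection (Divisible-*ˡ 1 (Integral-neg (Integral-recip-below 4 4<p)) harmonic-lower-congruence))
    where
    shape : ∀ t k → suc (4 ℕ.* t ℕ.+ 0) ℕ.+ 4 ℕ.* suc k
              ≡ suc (((t ℕ.+ suc k) ℕ.+ (t ℕ.+ suc k)) ℕ.+ ((t ℕ.+ suc k) ℕ.+ (t ℕ.+ suc k)))
    shape = ℕ.solve-∀
    A : ℚ
    A = ∑ (λ k → recip (suc (4 ℕ.* k ℕ.+ 0))) m
    reflection : Divisible 1 (A + recip 4 * harmonic m)
    reflection = subst (λ z → Divisible 1 (A + z)) (∑-recip-* 4 suc m)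
      (∑-reflect m (λ k → suc (4 ℕ.* k ℕ.+ 0)) (λ k → 4 ℕ.* suc k)
        (complementary (λ t → suc (4 ℕ.* t ℕ.+ 0)) (λ k → 4 ℕ.* suc k)
                       (λ x → suc ((x ℕ.+ x) ℕ.+ (x ℕ.+ x))) shape refl))
    rearrange : ∀ A H Q → (A + recip 4 * H) + (- recip 4) * (H + fromℕ 3 * Q) ≡ A - (+ 3 ℚ./ 4) * Q
    rearrange = solve-∀ ℚ-ring
    identity : (A + recip 4 * harmonic m) + (- recip 4) * (harmonic m + fromℕ 3 * Q) ≡ S 0 m₀ - (+ 3 ℚ./ 4) * Q
    identity = trans (rearrange A (harmonic m) Q) (cong (λ s → s - (+ 3 ℚ./ 4) * Q) (sym (S≡∑ 0 m₀)))

  S₁-congruence : Divisible 1 (S 1 m - (1ℚ - (+ 1 ℚ./ 4) * Q))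
  S₁-congruence = subst (Divisible 1) identity
    (Divisible-+ 1 (Divisible-*ˡ 1 Integral-half oddHarmonic-congruence)
                   (recip-shift 1 (s≤s z≤n) (ℕ.<-trans (s≤s (s≤s z≤n)) 2<p)))
    where
    form : ∀ m → suc (4 ℕ.* m ℕ.+ 1) ≡ suc ((m ℕ.+ m) ℕ.+ (m ℕ.+ m)) ℕ.+ 1
    form = ℕ.solve-∀
    R : ℚ
    R = recip (p ℕ.+ 1)
    rearrange : ∀ O Q R → recip 2 * (O + recip 2 * Q) + (fromℕ 1 * R - 1ℚ) ≡ (recip 2 * O + R) - (1ℚ - (+ 1 ℚ./ 4) * Q)
    rearrange = solve-∀ ℚ-ring
    identity : recip 2 * (oddHarmonic m + recip 2 * Q) + (fromℕ 1 * R - 1ℚ) ≡ S 1 m - (1ℚ - (+ 1 ℚ./ 4) * Q)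
    identity = trans (rearrange (oddHarmonic m) Q R)
      (cong (λ s → s - (1ℚ - (+ 1 ℚ./ 4) * Q)) (sym (trans (S≡∑ 1 m) (cong₂ _+_ (∑-4k+2 m) (cong recip (form m))))))

  S₂-congruence : Divisible 1 (S 2 m - ((+ 1 ℚ./ 2) + (+ 1 ℚ./ 4) * Q))
  S₂-congruence = subst (Divisible 1) identity
    (Divisible-+ 1 (Divisible-+ 1 reflection (Divisible-*ˡ 1 (Integral-neg Integral-half) oddHarmonic-congruence))
                   (Divisible-*ˡ 1 Integral-half (recip-shift 2 (s≤s z≤n) 2<p)))
    where
    shape : ∀ t k → suc (4 ℕ.* t ℕ.+ 2) ℕ.+ 2 ℕ.* suc (k ℕ.+ k)
              ≡ suc (((t ℕ.+ suc k) ℕ.+ (t ℕ.+ suc k)) ℕ.+ ((t ℕ.+ suc k) ℕ.+ (t ℕ.+ suc k)))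
    shape = ℕ.solve-∀
    form : ∀ m → suc (4 ℕ.* m ℕ.+ 2) ≡ suc ((m ℕ.+ m) ℕ.+ (m ℕ.+ m)) ℕ.+ 2
    form = ℕ.solve-∀
    A R : ℚ
    A = ∑ (λ k → recip (suc (4 ℕ.* k ℕ.+ 2))) m
    R = recip (p ℕ.+ 2)
    reflection : Divisible 1 (A + recip 2 * oddHarmonic m)
    reflection = subst (λ z → Divisible 1 (A + z)) (∑-recip-* 2 (λ k → suc (k ℕ.+ k)) m)
      (∑-reflect m (λ k → suc (4 ℕ.* k ℕ.+ 2)) (λ k → 2 ℕ.* suc (k ℕ.+ k))
        (complementary (λ t → suc (4 ℕ.* t ℕ.+ 2)) (λ k → 2 ℕ.* suc (k ℕ.+ k))
                       (λ x → suc ((x ℕ.+ x) ℕ.+ (x ℕ.+ x))) shape refl))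
    rearrange : ∀ A O Q R → ((A + recip 2 * O) + (- recip 2) * (O + recip 2 * Q)) + recip 2 * (fromℕ 2 * R - 1ℚ)
                            ≡ (A + R) - ((+ 1 ℚ./ 2) + (+ 1 ℚ./ 4) * Q)
    rearrange = solve-∀ ℚ-ring
    identity : ((A + recip 2 * oddHarmonic m) + (- recip 2) * (oddHarmonic m + recip 2 * Q)) + recip 2 * (fromℕ 2 * R - 1ℚ)
               ≡ S 2 m - ((+ 1 ℚ./ 2) + (+ 1 ℚ./ 4) * Q)
    identity = trans (rearrange A (oddHarmonic m) Q R)
      (cong (λ s → s - ((+ 1 ℚ./ 2) + (+ 1 ℚ./ 4) * Q)) (sym (trans (S≡∑ 2 m) (cong (λ r → A + recip r) (form m)))))

  congruences : ∀ {q} → q ≡ p →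
    (S 0 m₀ ≡ (+ 3 ℚ./ 4) * qp2 q [modℚ q ])
    × (S 1 m ≡ 1ℚ - (+ 1 ℚ./ 4) * qp2 q [modℚ q ])
    × (S 2 m ≡ (+ 1 ℚ./ 2) + (+ 1 ℚ./ 4) * qp2 q [modℚ q ])
  congruences refl = Divisible⇒≡[modℚ] (S 0 m₀) ((+ 3 ℚ./ 4) * Q) S₀-congruence
                   , Divisible⇒≡[modℚ] (S 1 m) (1ℚ - (+ 1 ℚ./ 4) * Q) S₁-congruence
                   , Divisible⇒≡[modℚ] (S 2 m) ((+ 1 ℚ./ 2) + (+ 1 ℚ./ 4) * Q) S₂-congruence

module QuarterSums≡3 (m₀ : ℕ) (prime : Prime (suc ((suc m₀ ℕ.+ suc (suc m₀)) ℕ.+ (suc m₀ ℕ.+ suc (suc m₀))))) where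

  m : ℕ
  m = suc m₀

  open pAdic prime
  open Harmonic m (suc m) (inj₂ refl) prime

  4<p : 4 < p
  4<p = subst (4 <_) (sym (form m₀)) (s≤s (s≤s (s≤s (s≤s (s≤s z≤n)))))
    where
    form : ∀ m₀ → suc ((suc m₀ ℕ.+ suc (suc m₀)) ℕ.+ (suc m₀ ℕ.+ suc (suc m₀))) ≡ 5 ℕ.+ (2 ℕ.+ 4 ℕ.* m₀)
    form = ℕ.solve-∀

  S₀-congruence : Divisible 1 (S 0 m - (+ 1 ℚ./ 4) * Q)
  S₀-congruence = subst (Divisible 1) identity
    (Divisible-+ 1 reflection (Divisible-*ˡ 1 (Integral-neg Integral-half) oddHarmonic-congruence))
    where
    shape : ∀ t k → suc (4 ℕ.* t ℕ.+ 0) ℕ.+ 2 ℕ.* suc (k ℕ.+ k)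
              ≡ suc (((t ℕ.+ k) ℕ.+ suc (t ℕ.+ k)) ℕ.+ ((t ℕ.+ k) ℕ.+ suc (t ℕ.+ k)))
    shape = ℕ.solve-∀
    complement : ∀ k → k < suc m → suc (4 ℕ.* (suc m ∸ suc k) ℕ.+ 0) ℕ.+ 2 ℕ.* suc (k ℕ.+ k) ≡ p
    complement k k<n = trans (shape t k) (cong (λ x → suc ((x ℕ.+ suc x) ℕ.+ (x ℕ.+ suc x))) t+k≡m)
      where
      t : ℕ
      t = suc m ∸ suc k
      t+k≡m : t ℕ.+ k ≡ m
      t+k≡m = ℕ.suc-injective (trans (sym (ℕ.+-suc t k)) (ℕ.m∸n+n≡m k<n))
    A : ℚ
    A = ∑ (λ k → recip (suc (4 ℕ.* k ℕ.+ 0))) (suc m)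
    reflection : Divisible 1 (A + recip 2 * oddHarmonic (suc m))
    reflection = subst (λ z → Divisible 1 (A + z)) (∑-recip-* 2 (λ k → suc (k ℕ.+ k)) (suc m))
      (∑-reflect (suc m) (λ k → suc (4 ℕ.* k ℕ.+ 0)) (λ k → 2 ℕ.* suc (k ℕ.+ k)) complement)
    rearrange : ∀ A O Q → (A + recip 2 * O) + (- recip 2) * (O + recip 2 * Q) ≡ A - (+ 1 ℚ./ 4) * Q
    rearrange = solve-∀ ℚ-ring
    identity : (A + recip 2 * oddHarmonic (suc m)) + (- recip 2) * (oddHarmonic (suc m) + recip 2 * Q) ≡ S 0 m - (+ 1 ℚ./ 4) * Q
    identity = trans (rearrange A (oddHarmonic (suc m)) Q) (cong (λ s → s - (+ 1 ℚ./ 4) * Q) (sym (S≡∑ 0 m)))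

  S₁-congruence : Divisible 1 (S 1 m - (- ((+ 1 ℚ./ 4) * Q)))
  S₁-congruence = subst (Divisible 1) identity (Divisible-*ˡ 1 Integral-half oddHarmonic-congruence)
    where
    rearrange : ∀ O Q → recip 2 * (O + recip 2 * Q) ≡ recip 2 * O - (- ((+ 1 ℚ./ 4) * Q))
    rearrange = solve-∀ ℚ-ring
    identity : recip 2 * (oddHarmonic (suc m) + recip 2 * Q) ≡ S 1 m - (- ((+ 1 ℚ./ 4) * Q))
    identity = trans (rearrange (oddHarmonic (suc m)) Q)
                     (cong (λ s → s - (- ((+ 1 ℚ./ 4) * Q))) (sym (trans (S≡∑ 1 m) (∑-4k+2 (suc m)))))

  S₂-congruence : Divisible 1 (S 2 m₀ - (+ 3 ℚ./ 4) * Q)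
  S₂-congruence = subst (Divisible 1) identity
    (Divisible-+ 1 reflection (Divisible-*ˡ 1 (Integral-neg (Integral-recip-below 4 4<p)) harmonic-lower-congruence))
    where
    shape : ∀ t k → suc (4 ℕ.* t ℕ.+ 2) ℕ.+ 4 ℕ.* suc k
              ≡ suc (((t ℕ.+ suc k) ℕ.+ suc (t ℕ.+ suc k)) ℕ.+ ((t ℕ.+ suc k) ℕ.+ suc (t ℕ.+ suc k)))
    shape = ℕ.solve-∀
    A : ℚ
    A = ∑ (λ k → recip (suc (4 ℕ.* k ℕ.+ 2))) m
    reflection : Divisible 1 (A + recip 4 * harmonic m)
    reflection = subst (λ z → Divisible 1 (A + z)) (∑-recip-* 4 suc m)
      (∑-reflect m (λ k → suc (4 ℕ.* k ℕ.+ 2)) (λ k → 4 ℕ.* suc k)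
        (complementary (λ t → suc (4 ℕ.* t ℕ.+ 2)) (λ k → 4 ℕ.* suc k)
                       (λ x → suc ((x ℕ.+ suc x) ℕ.+ (x ℕ.+ suc x))) shape refl))
    rearrange : ∀ A H Q → (A + recip 4 * H) + (- recip 4) * (H + fromℕ 3 * Q) ≡ A - (+ 3 ℚ./ 4) * Q
    rearrange = solve-∀ ℚ-ring
    identity : (A + recip 4 * harmonic m) + (- recip 4) * (harmonic m + fromℕ 3 * Q) ≡ S 2 m₀ - (+ 3 ℚ./ 4) * Q
    identity = trans (rearrange A (harmonic m) Q) (cong (λ s → s - (+ 3 ℚ./ 4) * Q) (sym (S≡∑ 2 m₀)))

  congruences : ∀ {q} → q ≡ p →
    (S 0 m ≡ (+ 1 ℚ./ 4) * qp2 q [modℚ q ])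
    × (S 1 m ≡ - ((+ 1 ℚ./ 4) * qp2 q) [modℚ q ])
    × (S 2 m₀ ≡ (+ 3 ℚ./ 4) * qp2 q [modℚ q ])
  congruences refl = Divisible⇒≡[modℚ] (S 0 m) ((+ 1 ℚ./ 4) * Q) S₀-congruence
                   , Divisible⇒≡[modℚ] (S 1 m) (- ((+ 1 ℚ./ 4) * Q)) S₁-congruence
                   , Divisible⇒≡[modℚ] (S 2 m₀) ((+ 3 ℚ./ 4) * Q) S₂-congruence

quotient-by-4 : ∀ {p r} → p % 4 ≡ r → r < 4 → 5 ≤ p → Σ ℕ λ q → p ≡ r ℕ.+ suc q ℕ.* 4
quotient-by-4 {p} {r} p%4≡r r<4 5≤p with p / 4 | trans (DM.m≡m%n+[m/n]*n p 4) (cong (ℕ._+ (p / 4) ℕ.* 4) p%4≡r)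
... | zero  | p≡r = ⊥-elim (ℕ.<⇒≱ (ℕ.<-trans r<4 (ℕ.n<1+n 4)) (subst (5 ≤_) (trans p≡r (ℕ.+-identityʳ r)) 5≤p))
... | suc q | p≡r = q , p≡r

p≡1[mod4]-congruences : ∀ p → Prime p → 5 ≤ p → p % 4 ≡ 1 →
  (S 0 ((p ∸ 5) / 4) ≡ (+ 3 ℚ./ 4) * qp2 p [modℚ p ])
  × (S 1 ((p ∸ 1) / 4) ≡ 1ℚ - (+ 1 ℚ./ 4) * qp2 p [modℚ p ])
  × (S 2 ((p ∸ 1) / 4) ≡ (+ 1 ℚ./ 2) + (+ 1 ℚ./ 4) * qp2 p [modℚ p ])
p≡1[mod4]-congruences p p-prime 5≤p p%4≡1 with quotient-by-4 p%4≡1 (s≤s (s≤s z≤n)) 5≤p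
... | m₀ , refl = subst₂ goal (sym (DM.m*n/n≡m m₀ 4)) (sym (DM.m*n/n≡m (suc m₀) 4))
                         (QuarterSums≡1.congruences m₀ (subst Prime (form m₀) p-prime) (form m₀))
  where
  q : ℕ
  q = 1 ℕ.+ suc m₀ ℕ.* 4
  goal : ℕ → ℕ → Set
  goal i j = (S 0 i ≡ (+ 3 ℚ./ 4) * qp2 q [modℚ q ])
           × (S 1 j ≡ 1ℚ - (+ 1 ℚ./ 4) * qp2 q [modℚ q ])
           × (S 2 j ≡ (+ 1 ℚ./ 2) + (+ 1 ℚ./ 4) * qp2 q [modℚ q ])
  form : ∀ m₀ → 1 ℕ.+ suc m₀ ℕ.* 4 ≡ suc ((suc m₀ ℕ.+ suc m₀) ℕ.+ (suc m₀ ℕ.+ suc m₀))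
  form = ℕ.solve-∀

p≡3[mod4]-congruences : ∀ p → Prime p → 5 ≤ p → p % 4 ≡ 3 →
  (S 0 ((p ∸ 3) / 4) ≡ (+ 1 ℚ./ 4) * qp2 p [modℚ p ])
  × (S 1 ((p ∸ 3) / 4) ≡ - ((+ 1 ℚ./ 4) * qp2 p) [modℚ p ])
  × (S 2 ((p ∸ 7) / 4) ≡ (+ 3 ℚ./ 4) * qp2 p [modℚ p ])
p≡3[mod4]-congruences p p-prime 5≤p p%4≡3 with quotient-by-4 p%4≡3 (s≤s (s≤s (s≤s (s≤s z≤n)))) 5≤p
... | m₀ , refl = subst₂ goal (sym (DM.m*n/n≡m (suc m₀) 4)) (sym (DM.m*n/n≡m m₀ 4))
                         (QuarterSums≡3.congruences m₀ (subst Prime (form m₀) p-prime) (form m₀))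
  where
  q : ℕ
  q = 3 ℕ.+ suc m₀ ℕ.* 4
  goal : ℕ → ℕ → Set
  goal i j = (S 0 i ≡ (+ 1 ℚ./ 4) * qp2 q [modℚ q ])
           × (S 1 i ≡ - ((+ 1 ℚ./ 4) * qp2 q) [modℚ q ])
           × (S 2 j ≡ (+ 3 ℚ./ 4) * qp2 q [modℚ q ])
  form : ∀ m₀ → 3 ℕ.+ suc m₀ ℕ.* 4 ≡ suc ((suc m₀ ℕ.+ suc (suc m₀)) ℕ.+ (suc m₀ ℕ.+ suc (suc m₀)))
  form = ℕ.solve-∀

lemma2 : (p : ℕ) → Prime p → 5 ≤ p →
    (p % 4 ≡ 1 →
      (S 0 ((p ∸ 5) / 4) ≡ (+ 3 ℚ./ 4) * qp2 p [modℚ p ])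
      × (S 1 ((p ∸ 1) / 4) ≡ 1ℚ - (+ 1 ℚ./ 4) * qp2 p [modℚ p ])
      × (S 2 ((p ∸ 1) / 4) ≡ (+ 1 ℚ./ 2) + (+ 1 ℚ./ 4) * qp2 p [modℚ p ]))
    × (p % 4 ≡ 3 →
      (S 0 ((p ∸ 3) / 4) ≡ (+ 1 ℚ./ 4) * qp2 p [modℚ p ])
      × (S 1 ((p ∸ 3) / 4) ≡ - ((+ 1 ℚ./ 4) * qp2 p) [modℚ p ])
      × (S 2 ((p ∸ 7) / 4) ≡ (+ 3 ℚ./ 4) * qp2 p [modℚ p ]))
lemma2 p p-prime 5≤p = p≡1[mod4]-congruences p p-prime 5≤p , p≡3[mod4]-congruences p p-prime 5≤p
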